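{- For every cycle $C_n$ ($n\geq 3$), $\mathrm{th}_{\mathrm{H}}(C_n)=\lceil 2\sqrt{n-2}+1\rceil$.
   Context: All graphs are finite, simple and undirected; $N(v)$ is the open neighborhood of $v$. Vertices are colored blue or white. Under the hopping color change rule, a blue vertex $v$ may force a white vertex $w$ (not necessarily adjacent to $v$) to become blue provided $v$ has not previously performed a force and every vertex of $N(v)$ is blue. Starting from an initial blue set $B\subseteq V(G)$, a chronological list of forces is a sequence of valid forces performed one at a time until no further force is possible; its unordered set of forces is a set of forces of $B$. $B$ is a hopping forcing set if some chronological list turns every vertex blue. For a set of forces $\mathcal F$ of $B$, put $\mathcal F^{(0)}=B$ and, for $t>0$, let $\mathcal F^{(t)}$ be the set of vertices $w$ for which there is a force $v\to w$ in $\mathcal F$ with $v\in\bigcup_{i<t}\mathcal F^{(i)}$ that is a valid hopping force when exactly the vertices of $\bigcup_{i<t}\mathcal F^{(i)}$ are blue. $\mathrm{pt}_{\mathrm{H}}(G;\mathcal F)$ is the least $t$ with $\bigcup_{i\le t}\mathcal F^{(i)}=V(G)$, and $\mathrm{pt}_{\mathrm{H}}(G;B)$ is the minimum of $\mathrm{pt}_{\mathrm{H}}(G;\mathcal F)$ over sets of forces $\mathcal F$ of $B$ ($\infty$ if $B$ is not a hopping forcing set). The hopping throttling number is $\mathrm{th}_{\mathrm{H}}(G)=\min_{B\subseteq V(G)}\big(|B|+\mathrm{pt}_{\mathrm{H}}(G;B)\big)$. -}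

module Defs where

open import Data.Nat using (ℕ; zero; suc; _+_; _*_; _≤_)
open import Data.Fin using (Fin; toℕ)
open import Data.Fin.Subset using (Subset; ∣_∣) renaming (_∈_ to _∈ˢ_)
open import Data.List using (List; []; _∷_; _++_; [_]; map)
open import Data.List.Membership.Propositional using (_∈_)
open import Data.Product using (_×_; _,_; proj₁; proj₂; ∃; ∃-syntax)
open import Data.Sum using (_⊎_)
open import Relation.Nullary using (¬_)
open import Relation.Binary.PropositionalEquality using (_≡_)

Rel : ℕ → Set₁
Rel n = Fin n → Fin n → Set

-- A force v → w is recorded as the pair (v , w).
Force : ℕ → Set
Force n = Fin n × Fin n

module _ {n : ℕ} (Adj : Rel n) where

  ValidHop : (Fin n → Set) → List (Force n) → Fin n → Fin n → Set
  ValidHop Blue done v w =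
    Blue v × ¬ Blue w × ¬ (v ∈ map proj₁ done) × (∀ u → Adj v u → Blue u)

  BlueAfter : Subset n → List (Force n) → Fin n → Set
  BlueAfter B L x = (x ∈ˢ B) ⊎ (x ∈ map proj₂ L)

  data ForceSeq (B : Subset n) : List (Force n) → Set where
    []   : ForceSeq B []
    snoc : ∀ {L v w} → ForceSeq B L →
           ValidHop (BlueAfter B L) L v w → ForceSeq B (L ++ [ (v , w) ])

  ChronList : Subset n → List (Force n) → Set
  ChronList B L = ForceSeq B L × (∀ v w → ¬ ValidHop (BlueAfter B L) L v w)

  -- Cumulative blue sets  ⋃_{i ≤ t} F^(i)  for the set of forces F (given as
  -- the members of the list L).
  Cum : Subset n → List (Force n) → ℕ → Fin n → Set
  Cum B L zero x = x ∈ˢ B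
  Cum B L (suc t) x =
    Cum B L t x ⊎
    (∃[ v ] ((v , x) ∈ L × Cum B L t v × ¬ Cum B L t x
             × (∀ u → Adj v u → Cum B L t u)))

  CompleteBy : Subset n → List (Force n) → ℕ → Set
  CompleteBy B L t = ∀ x → Cum B L t x

  ThH≡ : ℕ → Set
  ThH≡ k =
    (∃[ B ] ∃[ L ] ∃[ t ] (ChronList B L × CompleteBy B L t × ∣ B ∣ + t ≡ k))
    × (∀ B L t → ChronList B L → CompleteBy B L t → k ≤ ∣ B ∣ + t)

CycSucc : (n : ℕ) → Rel n
CycSucc n i j = (suc (toℕ i) ≡ toℕ j) ⊎ (suc (toℕ i) ≡ n × toℕ j ≡ 0)

Cycle : (n : ℕ) → Rel n
Cycle n i j = CycSucc n i j ⊎ CycSucc n j i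

-- j = ⌈ 2 √ m ⌉ : j is the least natural number with 4m ≤ j².
IsCeil2Sqrt : ℕ → ℕ → Set
IsCeil2Sqrt m j = (4 * m ≤ j * j) × (∀ i → 4 * m ≤ i * i → j ≤ i)

-- A hopping force needs its forcer to have all its neighbours blue, so a vertex
-- that turns blue in round r + 1 is either initially blue or forced by a vertex
-- interior to the round-r blue set, and each vertex forces at most once.  On the
-- cycle a proper vertex set with an interior vertex has at least two vertices that
-- are not interior, so every round adds at most |B| - 2 blue vertices and
-- n ≤ k + t (k - 2) for k = |B|.  By AM-GM, 4 (n - 2) ≤ 4 (t + 1) (k - 2) ≤ (k + t - 1)²,
-- hence k + t ≥ ⌈2√(n-2)⌉ + 1.  Conversely, start with the first A + 2 vertices
-- blue and let vertex i + 1 hop to vertex A + 2 + i: every round blues the next A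
-- vertices, so t rounds suffice once (t + 1) A ≥ n - 2, and A = ⌈j/2⌉, t + 1 = ⌊j/2⌋
-- achieve this at cost (A + 2) + t = j + 1.
module Submission where

open import Defs
open import Level using (Level)
open import Function using (_∘_; case_of_)
open import Data.Nat using (ℕ; zero; suc; _+_; _*_; _∸_; _≤_; _<_; z≤n; s≤s; NonZero; _%_; _/_; _≟_; _<?_)
import Data.Nat.Properties as ℕ
open import Data.Nat.DivMod
  using (_mod_; %-distribˡ-+; %-congˡ; m%n%n≡m%n; m<n⇒m%n≡m; n%n≡0; [m+n]%n≡m%n; m≡m%n+[m/n]*n; m%n<n)
open import Data.Nat.Tactic.RingSolver using (solve-∀)
open import Data.Fin using (Fin; zero; suc; toℕ)
open import Data.Fin.Properties using (any?; all?; toℕ-fromℕ<; toℕ-injective; toℕ<n) renaming (_≟_ to _≟ᶠ_)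
open import Data.Fin.Subset
  using (Subset; _∈_; _∉_; _⊆_; _⊂_; _∪_; _∩_; _-_; ∁; ⁅_⁆; ⊤; ⊥; ∣_∣; inside; outside)
open import Data.Fin.Subset.Properties
  using ( _∈?_; nonempty?; p⊆q⇒∣p∣≤∣q∣; p⊂q⇒∣p∣<∣q∣; x∈p∪q⁺; x∈p∩q⁺; x∈p∩q⁻; x∈⁅x⁆; ∣⁅x⁆∣≡1
        ; ∣p∩q∣≤∣p∣; ∣p∣≤n; ∣⊤∣≡n; ∣⊥∣≡0; ∉⊥; Empty-unique; x∈∁p⇒x∉p; ∣∁p∣≡n∸∣p∣
        ; x∈p∧x≢y⇒x∈p-y; x∈p⇒∣p-x∣<∣p∣)
open import Data.Vec using ([]; _∷_; here; there; tabulate)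
open import Data.Vec.Properties using (lookup⇒[]=; []=⇒lookup; lookup∘tabulate)
open import Data.List using (List; []; _++_; [_]; map)
open import Data.List.Membership.Propositional using () renaming (_∈_ to _∈ₗ_)
open import Data.List.Membership.Propositional.Properties using (∈-++⁻; ∈-++⁺ˡ; ∈-++⁺ʳ; ∈-map⁺; ∈-map⁻)
import Data.List.Membership.DecPropositional as DecMembership
open import Data.List.Relation.Unary.Any using (here)
open import Data.Product using (_×_; _,_; proj₁; proj₂; ∃₂; ∃-syntax)
open import Data.Product.Properties using (≡-dec)
open import Data.Sum using (_⊎_; inj₁; inj₂; [_,_]′) renaming (swap to ⊎-swap)
open import Relation.Nullary using (¬_; yes; no; does; contradiction)
open import Relation.Nullary.Decidable using (_×-dec_; _⊎-dec_; _→-dec_; ¬?; dec-true; decidable-stable)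
open import Relation.Unary using (Pred; Decidable)
open import Relation.Binary.Definitions using () renaming (Decidable to Decidable₂)
open import Relation.Binary.PropositionalEquality
  using (_≡_; _≢_; refl; sym; trans; cong; cong₂; subst; subst₂; module ≡-Reasoning)

private variable
  ℓ : Level
  n : ℕ

toSubset : {P : Pred (Fin n) ℓ} → Decidable P → Subset n
toSubset P? = tabulate (λ x → does (P? x))

module _ {P : Pred (Fin n) ℓ} (P? : Decidable P) where

  ∈-toSubset⁺ : ∀ {x} → P x → x ∈ toSubset P?
  ∈-toSubset⁺ {x} px = lookup⇒[]= x _ (trans (lookup∘tabulate _ x) (dec-true (P? x) px))

  ∈-toSubset⁻ : ∀ {x} → x ∈ toSubset P? → P x
  ∈-toSubset⁻ {x} x∈ with P? x | trans (sym (lookup∘tabulate (λ y → does (P? y)) x)) ([]=⇒lookup x∈)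
  ... | yes px | _  = px
  ... | no _   | ()

∣p∪q∣≤∣p∣+∣q∣ : ∀ (p q : Subset n) → ∣ p ∪ q ∣ ≤ ∣ p ∣ + ∣ q ∣
∣p∪q∣≤∣p∣+∣q∣ []            []            = z≤n
∣p∪q∣≤∣p∣+∣q∣ (outside ∷ p) (outside ∷ q) = ∣p∪q∣≤∣p∣+∣q∣ p q
∣p∪q∣≤∣p∣+∣q∣ (outside ∷ p) (inside ∷ q)  =
  ℕ.≤-trans (s≤s (∣p∪q∣≤∣p∣+∣q∣ p q)) (ℕ.≤-reflexive (sym (ℕ.+-suc ∣ p ∣ ∣ q ∣)))
∣p∪q∣≤∣p∣+∣q∣ (inside ∷ p)  (outside ∷ q) = s≤s (∣p∪q∣≤∣p∣+∣q∣ p q)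
∣p∪q∣≤∣p∣+∣q∣ (inside ∷ p)  (inside ∷ q)  =
  s≤s (ℕ.≤-trans (∣p∪q∣≤∣p∣+∣q∣ p q) (ℕ.+-monoʳ-≤ ∣ p ∣ (ℕ.n≤1+n ∣ q ∣)))

module _ {n : ℕ} where

  open DecMembership (≡-dec (_≟ᶠ_ {n}) (_≟ᶠ_ {n})) using () renaming (_∈?_ to _∈ₗ?_)

  TargetFrom : Subset n → List (Force n) → Pred (Fin n) _
  TargetFrom I L w = ∃[ v ] (v ∈ I × (v , w) ∈ₗ L)

  Source : List (Force n) → Pred (Fin n) _
  Source L v = ∃[ w ] ((v , w) ∈ₗ L)

  targetFrom? : ∀ I L → Decidable (TargetFrom I L)
  targetFrom? I L w = any? (λ v → (v ∈? I) ×-dec ((v , w) ∈ₗ? L))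

  source? : ∀ L → Decidable (Source L)
  source? L v = any? (λ w → (v , w) ∈ₗ? L)

  targetsFrom : Subset n → List (Force n) → Subset n
  targetsFrom I L = toSubset (targetFrom? I L)

  sources : List (Force n) → Subset n
  sources L = toSubset (source? L)

  ∩sources-++ : ∀ I L M → I ∩ sources L ⊆ I ∩ sources (L ++ M)
  ∩sources-++ I L M x∈ with x∈p∩q⁻ I (sources L) x∈
  ... | x∈I , x∈src with ∈-toSubset⁻ (source? L) x∈src
  ...   | w , xw∈L = x∈p∩q⁺ (x∈I , ∈-toSubset⁺ (source? (L ++ M)) (w , ∈-++⁺ˡ xw∈L))

  -- The sources of a valid sequence are fresh (ValidHop), so every target has its own source.
  ∣targetsFrom∣≤∣sources∣ : ∀ {Adj : Rel n} {B} I {L} → ForceSeq Adj B L →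
                            ∣ targetsFrom I L ∣ ≤ ∣ I ∩ sources L ∣
  ∣targetsFrom∣≤∣sources∣ I [] =
    p⊆q⇒∣p∣≤∣q∣ {p = targetsFrom I []} {q = I ∩ sources []}
                λ x∈ → case ∈-toSubset⁻ (targetFrom? I []) x∈ of λ ()
  ∣targetsFrom∣≤∣sources∣ I (snoc {L} {v} {w} seq (_ , _ , v-fresh , _)) with v ∈? I
  ... | yes v∈I = begin
    ∣ targetsFrom I L′ ∣             ≤⟨ p⊆q⇒∣p∣≤∣q∣ new-target ⟩
    ∣ ⁅ w ⁆ ∪ targetsFrom I L ∣      ≤⟨ ∣p∪q∣≤∣p∣+∣q∣ ⁅ w ⁆ _ ⟩
    ∣ ⁅ w ⁆ ∣ + ∣ targetsFrom I L ∣  ≡⟨ cong (_+ _) (∣⁅x⁆∣≡1 w) ⟩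
    suc ∣ targetsFrom I L ∣          ≤⟨ s≤s (∣targetsFrom∣≤∣sources∣ I seq) ⟩
    suc ∣ I ∩ sources L ∣            ≤⟨ p⊂q⇒∣p∣<∣q∣ new-source ⟩
    ∣ I ∩ sources L′ ∣               ∎
    where
    open ℕ.≤-Reasoning
    L′ = L ++ [ (v , w) ]
    new-target : targetsFrom I L′ ⊆ ⁅ w ⁆ ∪ targetsFrom I L
    new-target x∈ with ∈-toSubset⁻ (targetFrom? I L′) x∈
    ... | u , u∈I , ux∈ with ∈-++⁻ L ux∈
    ...   | inj₁ ux∈L        = x∈p∪q⁺ (inj₂ (∈-toSubset⁺ (targetFrom? I L) (u , u∈I , ux∈L)))
    ...   | inj₂ (here refl) = x∈p∪q⁺ (inj₁ (x∈⁅x⁆ w))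
    v∈sources : v ∈ I ∩ sources L′
    v∈sources = x∈p∩q⁺ (v∈I , ∈-toSubset⁺ (source? L′) (w , ∈-++⁺ʳ L (here refl)))
    v∉sources : v ∉ I ∩ sources L
    v∉sources v∈ = v-fresh (∈-map⁺ proj₁ (proj₂ (∈-toSubset⁻ (source? L) (proj₂ (x∈p∩q⁻ I _ v∈)))))
    new-source : I ∩ sources L ⊂ I ∩ sources L′
    new-source = ∩sources-++ I L _ , v , v∈sources , v∉sources
  ... | no v∉I = begin
    ∣ targetsFrom I (L ++ [ (v , w) ]) ∣  ≤⟨ p⊆q⇒∣p∣≤∣q∣ old-target ⟩
    ∣ targetsFrom I L ∣                   ≤⟨ ∣targetsFrom∣≤∣sources∣ I seq ⟩
    ∣ I ∩ sources L ∣                     ≤⟨ p⊆q⇒∣p∣≤∣q∣ (∩sources-++ I L _) ⟩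
    ∣ I ∩ sources (L ++ [ (v , w) ]) ∣    ∎
    where
    open ℕ.≤-Reasoning
    old-target : targetsFrom I (L ++ [ (v , w) ]) ⊆ targetsFrom I L
    old-target x∈ with ∈-toSubset⁻ (targetFrom? I (L ++ [ (v , w) ])) x∈
    ... | u , u∈I , ux∈ with ∈-++⁻ L ux∈
    ...   | inj₁ ux∈L        = ∈-toSubset⁺ (targetFrom? I L) (u , u∈I , ux∈L)
    ...   | inj₂ (here refl) = contradiction u∈I v∉I

Interior : Rel n → Subset n → Pred (Fin n) _
Interior Adj S v = v ∈ S × (∀ u → Adj v u → u ∈ S)

interior? : {Adj : Rel n} → Decidable₂ Adj → ∀ S → Decidable (Interior Adj S)
interior? Adj? S v = (v ∈? S) ×-dec all? (λ u → Adj? v u →-dec (u ∈? S))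

interior : {Adj : Rel n} → Decidable₂ Adj → Subset n → Subset n
interior Adj? S = toSubset (interior? Adj? S)

module Rounds {n : ℕ} {Adj : Rel n} (Adj? : Decidable₂ Adj) (B : Subset n) (L : List (Force n)) where

  open DecMembership (≡-dec (_≟ᶠ_ {n}) (_≟ᶠ_ {n})) using () renaming (_∈?_ to _∈ₗ?_)

  cum? : ∀ t → Decidable (Cum Adj B L t)
  cum? zero    x = x ∈? B
  cum? (suc t) x = cum? t x ⊎-dec any? λ v →
    ((v , x) ∈ₗ? L) ×-dec cum? t v ×-dec ¬? (cum? t x) ×-dec all? (λ u → Adj? v u →-dec cum? t u)

  blue : ℕ → Subset n
  blue t = toSubset (cum? t)

  B⊆blue : ∀ t → B ⊆ blue t
  B⊆blue t x∈B = ∈-toSubset⁺ (cum? t) (B⊆Cum t x∈B)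
    where
    B⊆Cum : ∀ t {x} → x ∈ B → Cum Adj B L t x
    B⊆Cum zero    x∈B = x∈B
    B⊆Cum (suc t) x∈B = inj₁ (B⊆Cum t x∈B)

  blue-zero⊆B : blue zero ⊆ B
  blue-zero⊆B = ∈-toSubset⁻ (cum? zero)

  complete⇒∣blue∣≡n : ∀ {t} → CompleteBy Adj B L t → ∣ blue t ∣ ≡ n
  complete⇒∣blue∣≡n {t} complete = ℕ.≤-antisym (∣p∣≤n (blue t)) (begin
    n         ≡⟨ ∣⊤∣≡n n ⟨
    ∣ ⊤ {n} ∣ ≤⟨ p⊆q⇒∣p∣≤∣q∣ {p = ⊤} (λ {x} _ → ∈-toSubset⁺ (cum? t) (complete x)) ⟩
    ∣ blue t ∣ ∎)
    where open ℕ.≤-Reasoning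

  blue-suc⊆ : ∀ r → blue (suc r) ⊆ B ∪ targetsFrom (interior Adj? (blue r)) L
  blue-suc⊆ r x∈ with forced r (∈-toSubset⁻ (cum? (suc r)) x∈)
    where
    forced : ∀ r {x} → Cum Adj B L (suc r) x →
             x ∈ B ⊎ ∃[ v ] ((v , x) ∈ₗ L × Cum Adj B L r v × (∀ u → Adj v u → Cum Adj B L r u))
    forced r       (inj₂ (v , vx∈L , v-blue , _ , nbrs-blue)) = inj₂ (v , vx∈L , v-blue , nbrs-blue)
    forced zero    (inj₁ x∈B) = inj₁ x∈B
    forced (suc r) (inj₁ earlier) with forced r earlier
    ... | inj₁ x∈B = inj₁ x∈B
    ... | inj₂ (v , vx∈L , v-blue , nbrs-blue) =
      inj₂ (v , vx∈L , inj₁ v-blue , λ u adj → inj₁ (nbrs-blue u adj))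
  ... | inj₁ x∈B = x∈p∪q⁺ (inj₁ x∈B)
  ... | inj₂ (v , vx∈L , v-blue , nbrs-blue) =
    x∈p∪q⁺ (inj₂ (∈-toSubset⁺ (targetFrom? _ L) (v , v∈int , vx∈L)))
    where
    v∈int : v ∈ interior Adj? (blue r)
    v∈int = ∈-toSubset⁺ (interior? Adj? (blue r))
              (∈-toSubset⁺ (cum? r) v-blue , λ u adj → ∈-toSubset⁺ (cum? r) (nbrs-blue u adj))

  ∣blue-suc∣≤∣B∣+∣interior∣ : ForceSeq Adj B L → ∀ r →
                              ∣ blue (suc r) ∣ ≤ ∣ B ∣ + ∣ interior Adj? (blue r) ∣
  ∣blue-suc∣≤∣B∣+∣interior∣ seq r = begin
    ∣ blue (suc r) ∣             ≤⟨ p⊆q⇒∣p∣≤∣q∣ (blue-suc⊆ r) ⟩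
    ∣ B ∪ targetsFrom I L ∣      ≤⟨ ∣p∪q∣≤∣p∣+∣q∣ B _ ⟩
    ∣ B ∣ + ∣ targetsFrom I L ∣  ≤⟨ ℕ.+-monoʳ-≤ ∣ B ∣ (∣targetsFrom∣≤∣sources∣ I seq) ⟩
    ∣ B ∣ + ∣ I ∩ sources L ∣    ≤⟨ ℕ.+-monoʳ-≤ ∣ B ∣ (∣p∩q∣≤∣p∣ I _) ⟩
    ∣ B ∣ + ∣ I ∣                ∎
    where
    open ℕ.≤-Reasoning
    I = interior Adj? (blue r)

cycleSucc? : ∀ n → Decidable₂ (CycSucc n)
cycleSucc? n u v = (suc (toℕ u) ≟ toℕ v) ⊎-dec ((suc (toℕ u) ≟ n) ×-dec (toℕ v ≟ 0))

cycle? : ∀ n → Decidable₂ (Cycle n)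
cycle? n u v = cycleSucc? n u v ⊎-dec cycleSucc? n v u

Cycle-nbr≤ : ∀ {v u : Fin n} → 1 ≤ toℕ v → suc (toℕ v) < n → Cycle n v u → toℕ u ≤ suc (toℕ v)
Cycle-nbr≤ _   _     (inj₁ (inj₁ v+1≡u))         = ℕ.≤-reflexive (sym v+1≡u)
Cycle-nbr≤ _   v+1<n (inj₁ (inj₂ (v+1≡n , _)))   = contradiction v+1≡n (ℕ.<⇒≢ v+1<n)
Cycle-nbr≤ _   _     (inj₂ (inj₁ u+1≡v))         = ℕ.m≤n⇒m≤1+n (ℕ.<⇒≤ (ℕ.≤-reflexive u+1≡v))
Cycle-nbr≤ 1≤v _     (inj₂ (inj₂ (_ , v≡0)))     = contradiction (subst (1 ≤_) v≡0 1≤v) λ ()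

module _ {n : ℕ} .{{_ : NonZero n}} where

  vertex : ℕ → Fin n
  vertex k = k mod n

  toℕ-vertex : ∀ k → toℕ (vertex k) ≡ k % n
  toℕ-vertex k = toℕ-fromℕ< _

  vertex-toℕ : ∀ v → vertex (toℕ v) ≡ v
  vertex-toℕ v = toℕ-injective (trans (toℕ-vertex (toℕ v)) (m<n⇒m%n≡m (toℕ<n v)))

  next : Fin n → Fin n
  next v = vertex (suc (toℕ v))

  Cycle-next : ∀ v → Cycle n v (next v)
  Cycle-next v with suc (toℕ v) ≟ n
  ... | yes last = inj₁ (inj₂ (last , trans (toℕ-vertex _) (trans (%-congˡ last) (n%n≡0 n))))
  ... | no ¬last = inj₁ (inj₁ (sym (trans (toℕ-vertex _) (m<n⇒m%n≡m (ℕ.≤∧≢⇒< (toℕ<n v) ¬last)))))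

  next-vertex : ∀ k → next (vertex k) ≡ vertex (suc k)
  next-vertex k = toℕ-injective (begin
    toℕ (next (vertex k))     ≡⟨ toℕ-vertex _ ⟩
    suc (toℕ (vertex k)) % n  ≡⟨ cong (λ m → suc m % n) (toℕ-vertex k) ⟩
    (1 + k % n) % n           ≡⟨ %-distribˡ-+ 1 (k % n) n ⟩
    (1 % n + k % n % n) % n   ≡⟨ cong (λ m → (1 % n + m) % n) (m%n%n≡m%n k n) ⟩
    (1 % n + k % n) % n       ≡⟨ %-distribˡ-+ 1 k n ⟨
    suc k % n                 ≡⟨ toℕ-vertex (suc k) ⟨
    toℕ (vertex (suc k))      ∎)
    where open ≡-Reasoning

  next-closed⇒all : {P : Pred (Fin n) ℓ} → (∀ v → P v → P (next v)) → ∀ {x} → P x → ∀ y → P y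
  next-closed⇒all {P = P} closed {x} Px y = subst P reaches-y (from-x (toℕ y + (n ∸ toℕ x)))
    where
    from-x : ∀ d → P (vertex (d + toℕ x))
    from-x zero    = subst P (sym (vertex-toℕ x)) Px
    from-x (suc d) = subst P (next-vertex (d + toℕ x)) (closed _ (from-x d))
    reaches-y : vertex (toℕ y + (n ∸ toℕ x) + toℕ x) ≡ y
    reaches-y = toℕ-injective (begin
      toℕ (vertex (toℕ y + (n ∸ toℕ x) + toℕ x))  ≡⟨ toℕ-vertex _ ⟩
      (toℕ y + (n ∸ toℕ x) + toℕ x) % n          ≡⟨ cong (_% n) (ℕ.+-assoc (toℕ y) _ _) ⟩
      (toℕ y + (n ∸ toℕ x + toℕ x)) % n          ≡⟨ cong (λ m → (toℕ y + m) % n) x-cancels ⟩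
      (toℕ y + n) % n                            ≡⟨ [m+n]%n≡m%n (toℕ y) n ⟩
      toℕ y % n                                  ≡⟨ m<n⇒m%n≡m (toℕ<n y) ⟩
      toℕ y                                      ∎)
      where
      open ≡-Reasoning
      x-cancels = ℕ.m∸n+n≡m (ℕ.<⇒≤ (toℕ<n x))

  ∃-exit : {P : Pred (Fin n) ℓ} → Decidable P → ∀ {x y} → P x → ¬ P y → ∃[ a ] (P a × ¬ P (next a))
  ∃-exit {P = P} P? Px ¬Py with any? (λ a → P? a ×-dec ¬? (P? (next a)))
  ... | yes exit = exit
  ... | no ¬exit = contradiction (next-closed⇒all closed Px _) ¬Py
    where
    closed : ∀ a → P a → P (next a)
    closed a Pa with P? (next a)
    ... | yes Pna = Pna
    ... | no ¬Pna = contradiction (a , Pa , ¬Pna) ¬exit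

  ∃-entry : {P : Pred (Fin n) ℓ} → Decidable P → ∀ {x y} → ¬ P x → P y → ∃[ a ] (¬ P a × P (next a))
  ∃-entry P? ¬Px Py with ∃-exit (¬? ∘ P?) ¬Px (λ ¬Py → ¬Py Py)
  ... | a , ¬Pa , ¬¬Pna = a , ¬Pa , decidable-stable (P? _) ¬¬Pna

  -- Walking forwards from x, S is left at some a (next a ∉ S) and entered at some
  -- b = next c (c ∉ S, next b ∈ S); neither is interior, and a ≢ b.
  2+∣interior∣≤∣S∣ : ∀ (S : Subset n) {x y} → Interior (Cycle n) S x → y ∉ S →
                     2 + ∣ interior (cycle? n) S ∣ ≤ ∣ S ∣
  2+∣interior∣≤∣S∣ S {x} (x∈S , x-nbrs∈S) y∉S
    with ∃-exit (_∈? S) x∈S y∉S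
       | ∃-entry (λ z → (z ∈? S) ×-dec (next z ∈? S)) (y∉S ∘ proj₁) (x∈S , x-nbrs∈S _ (Cycle-next x))
  ... | a , a∈S , next-a∉S | c , ¬[c∈S×b∈S] , b∈S , next-b∈S =
    ℕ.≤-<-trans (p⊂q⇒∣p∣<∣q∣ (int⊆S-b , a , x∈p∧x≢y⇒x∈p-y a∈S a≢b , a∉int)) (x∈p⇒∣p-x∣<∣p∣ b∈S)
    where
    int = interior (cycle? n) S
    b = next c
    int-nbrs∈S : ∀ {z} → z ∈ int → ∀ u → Cycle n z u → u ∈ S
    int-nbrs∈S z∈int = proj₂ (∈-toSubset⁻ (interior? (cycle? n) S) z∈int)
    a≢b : a ≢ b
    a≢b a≡b = next-a∉S (subst (λ z → next z ∈ S) (sym a≡b) next-b∈S)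
    a∉int : a ∉ int
    a∉int a∈int = next-a∉S (int-nbrs∈S a∈int _ (Cycle-next a))
    b∉int : b ∉ int
    b∉int b∈int = ¬[c∈S×b∈S] (int-nbrs∈S b∈int c (⊎-swap (Cycle-next c)) , b∈S)
    int⊆S-b : int ⊆ S - b
    int⊆S-b z∈int = x∈p∧x≢y⇒x∈p-y (proj₁ (∈-toSubset⁻ (interior? (cycle? n) S) z∈int))
                                  λ { refl → b∉int z∈int }

module _ {n : ℕ} .{{_ : NonZero n}} (B : Subset n) (L : List (Force n)) where

  open Rounds (cycle? n) B L

  ∣blue-suc∣≤∣blue∣+∣B∣∸2 : ForceSeq (Cycle n) B L → ∀ r →
                            ∣ blue (suc r) ∣ ≤ ∣ blue r ∣ + (∣ B ∣ ∸ 2)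
  ∣blue-suc∣≤∣blue∣+∣B∣∸2 seq r with nonempty? (∁ (blue r))
  ... | no ∁S-empty = ℕ.≤-trans (∣p∣≤n (blue (suc r))) (ℕ.≤-trans n≤∣S∣ (ℕ.m≤m+n _ _))
    where
    n≤∣S∣ : n ≤ ∣ blue r ∣
    n≤∣S∣ = ℕ.m∸n≡0⇒m≤n (trans (sym (∣∁p∣≡n∸∣p∣ (blue r)))
                               (trans (cong ∣_∣ (Empty-unique ∁S-empty)) (∣⊥∣≡0 n)))
  ... | yes (y , y∈∁S) with nonempty? (interior (cycle? n) (blue r))
  ...   | yes (x , x∈int) = begin
      ∣ blue (suc r) ∣                 ≤⟨ ∣blue-suc∣≤∣B∣+∣interior∣ seq r ⟩
      ∣ B ∣ + ∣ I ∣                    ≤⟨ ℕ.+-monoˡ-≤ ∣ I ∣ (ℕ.m≤n+m∸n ∣ B ∣ 2) ⟩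
      2 + (∣ B ∣ ∸ 2) + ∣ I ∣          ≡⟨ cong (2 +_) (ℕ.+-comm (∣ B ∣ ∸ 2) ∣ I ∣) ⟩
      2 + ∣ I ∣ + (∣ B ∣ ∸ 2)          ≤⟨ ℕ.+-monoˡ-≤ (∣ B ∣ ∸ 2) 2+∣I∣≤∣S∣ ⟩
      ∣ blue r ∣ + (∣ B ∣ ∸ 2)         ∎
    where
    open ℕ.≤-Reasoning
    I = interior (cycle? n) (blue r)
    2+∣I∣≤∣S∣ = 2+∣interior∣≤∣S∣ (blue r) (∈-toSubset⁻ (interior? (cycle? n) (blue r)) x∈int)
                                (x∈∁p⇒x∉p y∈∁S)
  ...   | no int-empty = begin
      ∣ blue (suc r) ∣                           ≤⟨ ∣blue-suc∣≤∣B∣+∣interior∣ seq r ⟩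
      ∣ B ∣ + ∣ interior (cycle? n) (blue r) ∣   ≡⟨ cong (λ S → ∣ B ∣ + ∣ S ∣) (Empty-unique int-empty) ⟩
      ∣ B ∣ + ∣ ⊥ {n} ∣                          ≡⟨ trans (cong (∣ B ∣ +_) (∣⊥∣≡0 n)) (ℕ.+-identityʳ ∣ B ∣) ⟩
      ∣ B ∣                                      ≤⟨ p⊆q⇒∣p∣≤∣q∣ (B⊆blue r) ⟩
      ∣ blue r ∣                                 ≤⟨ ℕ.m≤m+n _ _ ⟩
      ∣ blue r ∣ + (∣ B ∣ ∸ 2)                   ∎
    where open ℕ.≤-Reasoning

  ∣blue∣≤∣B∣+t*[∣B∣∸2] : ForceSeq (Cycle n) B L → ∀ t →
                         ∣ blue t ∣ ≤ ∣ B ∣ + t * (∣ B ∣ ∸ 2)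
  ∣blue∣≤∣B∣+t*[∣B∣∸2] seq zero    = ℕ.≤-trans (p⊆q⇒∣p∣≤∣q∣ blue-zero⊆B) (ℕ.m≤m+n ∣ B ∣ 0)
  ∣blue∣≤∣B∣+t*[∣B∣∸2] seq (suc t) = begin
    ∣ blue (suc t) ∣                        ≤⟨ ∣blue-suc∣≤∣blue∣+∣B∣∸2 seq t ⟩
    ∣ blue t ∣ + c                          ≤⟨ ℕ.+-monoˡ-≤ c (∣blue∣≤∣B∣+t*[∣B∣∸2] seq t) ⟩
    ∣ B ∣ + t * c + c                       ≡⟨ ℕ.+-assoc ∣ B ∣ _ _ ⟩
    ∣ B ∣ + (t * c + c)                     ≡⟨ cong (∣ B ∣ +_) (ℕ.+-comm (t * c) c) ⟩
    ∣ B ∣ + suc t * c                       ∎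
    where
    open ℕ.≤-Reasoning
    c = ∣ B ∣ ∸ 2

  complete⇒n≤∣B∣+t*[∣B∣∸2] : ForceSeq (Cycle n) B L → ∀ {t} → CompleteBy (Cycle n) B L t →
                             n ≤ ∣ B ∣ + t * (∣ B ∣ ∸ 2)
  complete⇒n≤∣B∣+t*[∣B∣∸2] seq {t} complete =
    subst (_≤ ∣ B ∣ + t * (∣ B ∣ ∸ 2)) (complete⇒∣blue∣≡n complete) (∣blue∣≤∣B∣+t*[∣B∣∸2] seq t)

square-of-sum : ∀ x d → (x + (x + d)) * (x + (x + d)) ≡ 4 * (x * (x + d)) + d * d
square-of-sum = solve-∀

4xy≤[x+y]² : ∀ x y → 4 * (x * y) ≤ (x + y) * (x + y)
4xy≤[x+y]² x y = [ ordered , flipped ]′ (ℕ.≤-total x y)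
  where
  ordered : ∀ {x y} → x ≤ y → 4 * (x * y) ≤ (x + y) * (x + y)
  ordered {x} x≤y with ℕ.m≤n⇒∃[o]m+o≡n x≤y
  ... | d , refl = ℕ.≤-trans (ℕ.m≤m+n _ (d * d)) (ℕ.≤-reflexive (sym (square-of-sum x d)))
  flipped : y ≤ x → 4 * (x * y) ≤ (x + y) * (x + y)
  flipped y≤x = subst₂ _≤_ (cong (4 *_) (ℕ.*-comm y x)) (cong₂ _*_ (ℕ.+-comm y x) (ℕ.+-comm y x))
                           (ordered y≤x)

1+j≤k+t : ∀ {n k t j} → 3 ≤ n → n ≤ k + t * (k ∸ 2) →
          (∀ i → 4 * (n ∸ 2) ≤ i * i → j ≤ i) → suc j ≤ k + t
1+j≤k+t {n} {k = zero} {t} 3≤n n≤ _ =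
  contradiction (ℕ.≤-trans 3≤n (subst (n ≤_) (ℕ.*-zeroʳ t) n≤)) λ ()
1+j≤k+t {n} {k = suc zero} {t} 3≤n n≤ _ =
  contradiction (ℕ.≤-trans 3≤n (subst (n ≤_) (cong suc (ℕ.*-zeroʳ t)) n≤)) λ { (s≤s ()) }
1+j≤k+t {n} {k = suc (suc c)} {t} _ n≤ least =
  s≤s (ℕ.≤-trans (least (suc t + c) 4[n∸2]≤) (ℕ.≤-reflexive (cong suc (ℕ.+-comm t c))))
  where
  4[n∸2]≤ : 4 * (n ∸ 2) ≤ (suc t + c) * (suc t + c)
  4[n∸2]≤ = ℕ.≤-trans (ℕ.*-monoʳ-≤ 4 (ℕ.∸-monoˡ-≤ 2 n≤)) (4xy≤[x+y]² (suc t) c)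

halves : ∀ j → j / 2 + (j / 2 + j % 2) ≡ j
halves j = sym (trans (m≡m%n+[m/n]*n j 2) (regroup (j % 2) (j / 2)))
  where
  regroup : ∀ d h → d + h * 2 ≡ h + (h + d)
  regroup = solve-∀

4m≤4a+1⇒m≤a : ∀ {m a} → 4 * m ≤ 4 * a + 1 → m ≤ a
4m≤4a+1⇒m≤a {m} {a} le = ℕ.≤-pred (ℕ.*-cancelˡ-< 4 m (suc a) (begin-strict
  4 * m      ≤⟨ le ⟩
  4 * a + 1  <⟨ ℕ.+-monoʳ-< (4 * a) (s≤s (s≤s z≤n)) ⟩
  4 * a + 4  ≡⟨ ℕ.+-comm (4 * a) 4 ⟩
  4 + 4 * a  ≡⟨ ℕ.*-suc 4 a ⟨
  4 * suc a  ∎))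
  where open ℕ.≤-Reasoning

balanced-split : ∀ {m j} → 4 * m ≤ j * j → ∃₂ λ a b → a + b ≡ j × m ≤ a * b
balanced-split {m} {j} 4m≤j² = h , h + d , halves j , 4m≤4a+1⇒m≤a (begin
  4 * m                          ≤⟨ 4m≤j² ⟩
  j * j                          ≡⟨ cong (λ k → k * k) (halves j) ⟨
  (h + (h + d)) * (h + (h + d))  ≡⟨ square-of-sum h d ⟩
  4 * (h * (h + d)) + d * d      ≤⟨ ℕ.+-monoʳ-≤ _ (ℕ.*-mono-≤ d≤1 d≤1) ⟩
  4 * (h * (h + d)) + 1          ∎)
  where
  open ℕ.≤-Reasoning
  h = j / 2
  d = j % 2
  d≤1 : d ≤ 1
  d≤1 = ℕ.≤-pred (m%n<n j 2)

initialSegment : ℕ → (n : ℕ) → Subset n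
initialSegment zero    n       = ⊥
initialSegment (suc c) zero    = []
initialSegment (suc c) (suc n) = inside ∷ initialSegment c n

∈-initialSegment⁺ : ∀ c {x : Fin n} → toℕ x < c → x ∈ initialSegment c n
∈-initialSegment⁺ (suc c) {zero}  _         = here
∈-initialSegment⁺ (suc c) {suc x} (s≤s x<c) = there (∈-initialSegment⁺ c x<c)

∈-initialSegment⁻ : ∀ c {x : Fin n} → x ∈ initialSegment c n → toℕ x < c
∈-initialSegment⁻ zero    x∈                 = contradiction x∈ ∉⊥
∈-initialSegment⁻ (suc c) {zero}  _          = s≤s z≤n
∈-initialSegment⁻ (suc c) {suc x} (there x∈) = s≤s (∈-initialSegment⁻ c x∈)

∣initialSegment∣≤ : ∀ c n → ∣ initialSegment c n ∣ ≤ c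
∣initialSegment∣≤ zero    n       = ℕ.≤-reflexive (∣⊥∣≡0 n)
∣initialSegment∣≤ (suc c) zero    = z≤n
∣initialSegment∣≤ (suc c) (suc n) = s≤s (∣initialSegment∣≤ c n)

-- The seeds are the vertices 0, …, K - 1 and force i is the hop (i + 1) → (K + i):
-- vertex i + 1 may hop as soon as i + 2 is blue, so each round blues A new vertices.
module Sweep {n : ℕ} .{{_ : NonZero n}} (a : ℕ) where

  A K M : ℕ
  A = suc a
  K = 2 + A
  M = n ∸ K

  seeds : Subset n
  seeds = initialSegment K n

  force : ℕ → Force n
  force i = vertex (suc i) , vertex (K + i)

  forcesUpTo : ℕ → List (Force n)
  forcesUpTo zero    = []
  forcesUpTo (suc m) = forcesUpTo m ++ [ force m ]

  forces : List (Force n)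
  forces = forcesUpTo M

  ∈-forcesUpTo⁺ : ∀ {i m} → i < m → force i ∈ₗ forcesUpTo m
  ∈-forcesUpTo⁺ {i} {suc m} i<1+m with ℕ.m≤n⇒m<n∨m≡n (ℕ.≤-pred i<1+m)
  ... | inj₁ i<m  = ∈-++⁺ˡ (∈-forcesUpTo⁺ i<m)
  ... | inj₂ refl = ∈-++⁺ʳ (forcesUpTo m) (here refl)

  ∈-forcesUpTo⁻ : ∀ {p} m → p ∈ₗ forcesUpTo m → ∃[ i ] (i < m × p ≡ force i)
  ∈-forcesUpTo⁻ (suc m) p∈ with ∈-++⁻ (forcesUpTo m) p∈
  ... | inj₁ p∈′ = let (i , i<m , p≡) = ∈-forcesUpTo⁻ m p∈′ in i , ℕ.m≤n⇒m≤1+n i<m , p≡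
  ... | inj₂ (here p≡) = m , ℕ.≤-refl , p≡

  <M⇒K+<n : ∀ {i} → i < M → K + i < n
  <M⇒K+<n {i} i<M = subst (K + i <_) (ℕ.m+[n∸m]≡n K≤n) (ℕ.+-monoʳ-< K i<M)
    where
    K≤n : K ≤ n
    K≤n = ℕ.<⇒≤ (ℕ.m∸n≢0⇒n<m λ M≡0 → contradiction (subst (i <_) M≡0 i<M) λ ())

  K+<n⇒<M : ∀ {i} → K + i < n → i < M
  K+<n⇒<M {i} K+i<n = subst (_< M) (ℕ.m+n∸m≡n K i) (ℕ.∸-monoˡ-< K+i<n (ℕ.m≤m+n K i))

  toℕ-source : ∀ {i} → i < M → toℕ (vertex (suc i)) ≡ suc i
  toℕ-source i<M =
    trans (toℕ-vertex _) (m<n⇒m%n≡m (ℕ.≤-<-trans (s≤s (ℕ.m≤n+m _ (suc (suc a)))) (<M⇒K+<n i<M)))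

  toℕ-target : ∀ {i} → i < M → toℕ (vertex (K + i)) ≡ K + i
  toℕ-target i<M = trans (toℕ-vertex _) (m<n⇒m%n≡m (<M⇒K+<n i<M))

  vertex-split : ∀ {y : Fin n} → K ≤ toℕ y → y ≡ vertex (K + (toℕ y ∸ K))
  vertex-split {y} K≤y = trans (sym (vertex-toℕ y)) (cong vertex (sym (ℕ.m+[n∸m]≡n K≤y)))

  source-nbr≤ : ∀ {i u} → i < M → Cycle n (vertex (suc i)) u → toℕ u ≤ suc (suc i)
  source-nbr≤ {i} i<M adj = subst (λ s → _ ≤ suc s) (toℕ-source i<M)
    (Cycle-nbr≤ (subst (1 ≤_) (sym (toℕ-source i<M)) (s≤s z≤n))
                (subst (λ s → suc s < n) (sym (toℕ-source i<M))
                       (ℕ.≤-<-trans (s≤s (s≤s (ℕ.m≤n+m i (suc a)))) (<M⇒K+<n i<M)))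
                adj)

  Blue : ℕ → Pred (Fin n) _
  Blue m = BlueAfter (Cycle n) seeds (forcesUpTo m)

  blue⁺ : ∀ {m y} → m ≤ M → toℕ y < K + m → Blue m y
  blue⁺ {m} {y} m≤M y<K+m with toℕ y <? K
  ... | yes y<K = inj₁ (∈-initialSegment⁺ K y<K)
  ... | no y≮K  = inj₂ (subst (_∈ₗ map proj₂ (forcesUpTo m)) (sym (vertex-split K≤y))
                              (∈-map⁺ proj₂ (∈-forcesUpTo⁺ i<m)))
    where
    K≤y = ℕ.≮⇒≥ y≮K
    i<m : toℕ y ∸ K < m
    i<m = ℕ.+-cancelˡ-< K _ _ (subst (_< K + m) (sym (ℕ.m+[n∸m]≡n K≤y)) y<K+m)

  blue⁻ : ∀ {m y} → m ≤ M → Blue m y → toℕ y < K + m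
  blue⁻ {m} m≤M (inj₁ y∈seeds) = ℕ.<-≤-trans (∈-initialSegment⁻ K y∈seeds) (ℕ.m≤m+n K m)
  blue⁻ {m} m≤M (inj₂ y∈targets) with ∈-map⁻ proj₂ y∈targets
  ... | p , p∈ , refl with ∈-forcesUpTo⁻ m p∈
  ...   | i , i<m , refl = subst (_< K + m) (sym (toℕ-target (ℕ.<-≤-trans i<m m≤M))) (ℕ.+-monoʳ-< K i<m)

  source-fresh : ∀ {m} → m < M → ¬ (vertex (suc m) ∈ₗ map proj₁ (forcesUpTo m))
  source-fresh {m} m<M v∈ with ∈-map⁻ proj₁ v∈
  ... | p , p∈ , v≡ with ∈-forcesUpTo⁻ m p∈
  ...   | i , i<m , refl = ℕ.<-irrefl (ℕ.suc-injective i+1≡m+1) i<m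
    where
    i+1≡m+1 : suc i ≡ suc m
    i+1≡m+1 = trans (sym (toℕ-source (ℕ.<-trans i<m m<M))) (trans (cong toℕ (sym v≡)) (toℕ-source m<M))

  valid : ∀ {m} → m < M → ValidHop (Cycle n) (Blue m) (forcesUpTo m) (vertex (suc m)) (vertex (K + m))
  valid {m} m<M = blue⁺ m≤M source<K+m , target-white , source-fresh m<M , nbrs-blue
    where
    m≤M = ℕ.<⇒≤ m<M
    source<K+m : toℕ (vertex (suc m)) < K + m
    source<K+m = subst (_< K + m) (sym (toℕ-source m<M)) (s≤s (s≤s (ℕ.m≤n+m m (suc a))))
    target-white : ¬ Blue m (vertex (K + m))
    target-white blue = ℕ.<-irrefl (toℕ-target m<M) (blue⁻ m≤M blue)
    nbrs-blue : ∀ u → Cycle n (vertex (suc m)) u → Blue m u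
    nbrs-blue u adj = blue⁺ m≤M (ℕ.≤-<-trans (source-nbr≤ m<M adj) (s≤s (s≤s (s≤s (ℕ.m≤n+m m a)))))

  forceSeq : ∀ m → m ≤ M → ForceSeq (Cycle n) seeds (forcesUpTo m)
  forceSeq zero    _   = []
  forceSeq (suc m) m<M = snoc (forceSeq m (ℕ.<⇒≤ m<M)) (valid m<M)

  chronList : ChronList (Cycle n) seeds forces
  chronList = forceSeq M ℕ.≤-refl , λ v w hop →
    proj₁ (proj₂ hop) (blue⁺ ℕ.≤-refl (ℕ.<-≤-trans (toℕ<n w) (ℕ.m≤n+m∸n n K)))

  cum : ∀ t x → toℕ x < K + t * A → Cum (Cycle n) seeds forces t x
  cum zero    x x<K+0 = ∈-initialSegment⁺ K (subst (toℕ x <_) (ℕ.+-identityʳ K) x<K+0)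
  cum (suc t) x x<bound with Rounds.cum? (cycle? n) seeds forces t x
  ... | yes earlier = inj₁ earlier
  ... | no ¬earlier =
    inj₂ (vertex (suc i) , forced , cum t _ source< , ¬earlier , λ u adj → cum t u (nbr< adj))
    where
    K+tA≤x : K + t * A ≤ toℕ x
    K+tA≤x = ℕ.≮⇒≥ λ x< → ¬earlier (cum t x x<)
    K≤x = ℕ.≤-trans (ℕ.m≤m+n K _) K+tA≤x
    i = toℕ x ∸ K
    i<M : i < M
    i<M = K+<n⇒<M (subst (_< n) (sym (ℕ.m+[n∸m]≡n K≤x)) (toℕ<n x))
    i<A+tA : i < A + t * A
    i<A+tA = ℕ.+-cancelˡ-< K _ _ (subst (_< K + suc t * A) (sym (ℕ.m+[n∸m]≡n K≤x)) x<bound)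
    forced : (vertex (suc i) , x) ∈ₗ forces
    forced = subst (λ y → (vertex (suc i) , y) ∈ₗ forces) (sym (vertex-split K≤x)) (∈-forcesUpTo⁺ i<M)
    source< : toℕ (vertex (suc i)) < K + t * A
    source< = subst (_< K + t * A) (sym (toℕ-source i<M)) (s≤s (ℕ.≤-trans i<A+tA (ℕ.n≤1+n _)))
    nbr< : ∀ {u} → Cycle n (vertex (suc i)) u → toℕ u < K + t * A
    nbr< adj = ℕ.≤-<-trans (source-nbr≤ i<M adj) (s≤s (s≤s i<A+tA))

cycle-throttling-upper : ∀ {n j} .{{_ : NonZero n}} → 3 ≤ n → 4 * (n ∸ 2) ≤ j * j →
  ∃[ B ] ∃[ L ] ∃[ t ] (ChronList (Cycle n) B L × CompleteBy (Cycle n) B L t × ∣ B ∣ + t ≤ suc j)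
cycle-throttling-upper {n} {j} 3≤n 4[n∸2]≤j² with balanced-split {n ∸ 2} {j} 4[n∸2]≤j²
... | zero , _ , _ , n∸2≤0 = contradiction (ℕ.≤-trans (ℕ.∸-monoˡ-≤ 2 3≤n) n∸2≤0) λ ()
... | suc t , zero , _ , n∸2≤ =
  contradiction (ℕ.≤-trans (ℕ.∸-monoˡ-≤ 2 3≤n) (subst (n ∸ 2 ≤_) (ℕ.*-zeroʳ (suc t)) n∸2≤)) λ ()
... | suc t , suc a , refl , n∸2≤ = seeds , forces , t , chronList , complete , cost
  where
  open Sweep a
  complete : CompleteBy (Cycle n) seeds forces t
  complete x = cum t x (ℕ.<-≤-trans (toℕ<n x) (ℕ.≤-trans (ℕ.m≤n+m∸n n 2) (ℕ.+-monoʳ-≤ 2 n∸2≤)))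
  cost : ∣ seeds ∣ + t ≤ suc (suc t + suc a)
  cost = ℕ.≤-trans (ℕ.+-monoˡ-≤ t (∣initialSegment∣≤ K n))
           (ℕ.≤-reflexive (cong (λ s → suc (suc s)) (trans (cong suc (ℕ.+-comm a t)) (sym (ℕ.+-suc t a)))))

proposition3p6 : (n : ℕ) → 3 ≤ n → (j : ℕ) → IsCeil2Sqrt (n ∸ 2) j →
                 ThH≡ (Cycle n) (suc j)
proposition3p6 zero () _ _
proposition3p6 n@(suc _) 3≤n j (4[n∸2]≤j² , least) with cycle-throttling-upper {n} {j} 3≤n 4[n∸2]≤j²
... | B , L , t , chron , complete , cost≤ =
  (B , L , t , chron , complete , ℕ.≤-antisym cost≤ (lower B L t chron complete)) , lower
  where
  lower : ∀ B L t → ChronList (Cycle n) B L → CompleteBy (Cycle n) B L t → suc j ≤ ∣ B ∣ + t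
  lower B L t (seq , _) complete =
    1+j≤k+t {k = ∣ B ∣} {t} 3≤n (complete⇒n≤∣B∣+t*[∣B∣∸2] B L seq complete) least
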